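{- Let $n\ge3$ and $D_n=\langle a,b\mid a^n=b^2=1,\ ab=ba^{ -1}\rangle$, and let $\tau(n)$ be the number of positive divisors of $n$. Then $\Gamma(D_n)\cong K_r+\Gamma_N(D_n)$, where $r=\tau(n)+1$ if $n$ is even and $r=\tau(n)-1$ if $n$ is odd.
   Context: For a group $G$, $\Gamma(G)$ is the simple graph whose vertices are the subgroups of $G$ other than $\{1\}$ and $G$, and $\Gamma_N(G)$ is the simple graph whose vertices are the proper non-normal subgroups of $G$; in both, two distinct vertices $H,K$ are adjacent iff $HK=KH$. $K_r$ is the complete graph on $r$ vertices and $G_1+G_2$ is the join (disjoint union plus all edges between $G_1$ and $G_2$). -}

module Defs where

open import Data.Nat using (ℕ; zero; suc; _+_; _∸_; NonZero)
open import Data.Nat.DivMod using (_%_; m%n<n)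
open import Data.Nat.Divisibility using (_∣_; _∣?_)
open import Data.Fin using (Fin; toℕ; fromℕ<)
open import Data.Fin.Subset using (Subset) renaming (_∈_ to _∈ₛ_)
open import Data.List using (List; length; filter; map; upTo)
open import Data.Product using (_×_; Σ-syntax; ∃-syntax; _,_)
open import Data.Sum using (_⊎_; inj₁; inj₂)
open import Data.Unit using (⊤)
open import Data.Empty using (⊥)
open import Relation.Nullary using (¬_)
open import Relation.Binary.PropositionalEquality using (_≡_; _≢_)
open import Function.Bundles using (_⇔_)

τ : ℕ → ℕ
τ n = length (filter (λ d → d ∣? n) (map suc (upTo n)))

module _ (n : ℕ) .{{_ : NonZero n}} where

  _⊕_ : Fin n → Fin n → Fin n
  i ⊕ j = fromℕ< (m%n<n (toℕ i + toℕ j) n)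

  ⊝_ : Fin n → Fin n
  ⊝ i = fromℕ< (m%n<n (n ∸ toℕ i) n)

  zeroF : Fin n
  zeroF = fromℕ< (m%n<n 0 n)

-- The dihedral group D_n = ⟨ a, b | aⁿ = b² = 1, ab = ba⁻¹ ⟩ of order 2n,
-- concretely: rot k = aᵏ, ref k = aᵏ b  (k ∈ ℤ/nℤ).

data Dih (n : ℕ) : Set where
  rot : Fin n → Dih n
  ref : Fin n → Dih n

module _ {n : ℕ} .{{_ : NonZero n}} where

  private
    _+'_ = _⊕_ n
    -'_ = ⊝_ n

  -- multiplication, using b aʲ = a⁻ʲ b and b² = 1
  _·_ : Dih n → Dih n → Dih n
  rot i · rot j = rot (i +' j)
  rot i · ref j = ref (i +' j)
  ref i · rot j = ref (i +' (-' j))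
  ref i · ref j = rot (i +' (-' j))

  e : Dih n
  e = rot (zeroF n)

  inv : Dih n → Dih n
  inv (rot i) = rot (-' i)
  inv (ref i) = ref i

-- Subsets of D_n: a pair (R , F) of subsets of ℤ/nℤ, where
-- aᵏ ∈ (R , F) iff k ∈ R and aᵏb ∈ (R , F) iff k ∈ F.
-- Propositional equality of such subsets is equality of sets.

SubD : ℕ → Set
SubD n = Subset n × Subset n

infix 4 _∈_
_∈_ : {n : ℕ} → Dih n → SubD n → Set
rot k ∈ (R , F) = k ∈ₛ R
ref k ∈ (R , F) = k ∈ₛ F

module _ {n : ℕ} .{{_ : NonZero n}} where

  record IsSubgroup (H : SubD n) : Set where
    field
      one∈  : e ∈ H
      mul∈  : ∀ x y → x ∈ H → y ∈ H → (x · y) ∈ H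
      inv∈  : ∀ x → x ∈ H → inv x ∈ H

  IsTrivial : SubD n → Set
  IsTrivial H = ∀ x → (x ∈ H) ⇔ (x ≡ e)

  IsWhole : SubD n → Set
  IsWhole H = ∀ x → x ∈ H

  IsNormal : SubD n → Set
  IsNormal H = ∀ g h → h ∈ H → ((g · h) · inv g) ∈ H

  _∈Prod_,_ : Dih n → SubD n → SubD n → Set
  x ∈Prod H , K = ∃[ h ] ∃[ k ] (h ∈ H × k ∈ K × x ≡ h · k)

  Permutable : SubD n → SubD n → Set
  Permutable H K = ∀ x → (x ∈Prod H , K) ⇔ (x ∈Prod K , H)

record Graph : Set₁ where
  field
    V   : Set
    Adj : V → V → Set

open Graph public

record _≅_ (G H : Graph) : Set where
  field
    to      : V G → V H
    from    : V H → V G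
    from∘to : ∀ x → from (to x) ≡ x
    to∘from : ∀ y → to (from y) ≡ y
    adj     : ∀ x y → Adj G x y ⇔ Adj H (to x) (to y)

K : ℕ → Graph
K r = record { V = Fin r ; Adj = λ i j → i ≢ j }

_⊞_ : Graph → Graph → Graph
G₁ ⊞ G₂ = record { V = V G₁ ⊎ V G₂ ; Adj = adj }
  where
  adj : V G₁ ⊎ V G₂ → V G₁ ⊎ V G₂ → Set
  adj (inj₁ x) (inj₁ y) = Adj G₁ x y
  adj (inj₁ x) (inj₂ y) = ⊤
  adj (inj₂ x) (inj₁ y) = ⊤
  adj (inj₂ x) (inj₂ y) = Adj G₂ x y

-- Γ(D_n) and Γ_N(D_n).  Vertices carry their subset together with
-- irrelevant proofs of the defining properties, so two vertices are
-- equal iff they are the same subgroup.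

module _ (n : ℕ) .{{_ : NonZero n}} where

  record ΓVertex : Set where
    constructor γv
    field
      carrier    : SubD n
      .subgroup  : IsSubgroup carrier
      .nontrivial : ¬ IsTrivial carrier
      .proper    : ¬ IsWhole carrier

  record ΓNVertex : Set where
    constructor γnv
    field
      carrier   : SubD n
      .subgroup : IsSubgroup carrier
      .proper   : ¬ IsWhole carrier
      .nonnormal : ¬ IsNormal carrier

  Γ : Graph
  Γ = record
    { V   = ΓVertex
    ; Adj = λ H K → ΓVertex.carrier H ≢ ΓVertex.carrier K
                  × Permutable (ΓVertex.carrier H) (ΓVertex.carrier K) }

  ΓN : Graph
  ΓN = record
    { V   = ΓNVertex
    ; Adj = λ H K → ΓNVertex.carrier H ≢ ΓNVertex.carrier K
                  × Permutable (ΓNVertex.carrier H) (ΓNVertex.carrier K) }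

module Submission where

-- A normal subgroup permutes with every subgroup, and among the normal
-- subgroups only {1} and Dₙ are missing from Γ(Dₙ).  So once the nontrivial
-- proper normal subgroups are enumerated without repetition by Fin r, the
-- vertices of Γ(Dₙ) split into a clique K_r joined to everything and the
-- proper non-normal subgroups, i.e. Γ_N(Dₙ) (`NormalEnumeration`, `Γ≅K⊞ΓN`).
-- It remains to list these subgroups:
--  * a subgroup without reflections is ⟨aᵈ⟩, d the least positive exponent
--    with aᵈ in it, a divisor of n (`reflection-free⇒⟨a^⟩`); the nontrivial
--    ones are the τ(n) − 1 subgroups ⟨aᵈ⟩ with 0 < d < n, all normal;
--  * a normal subgroup containing a reflection contains every a²ᵗ
--    (`doubles∈`).  For odd n this already gives all of Dₙ; for even n a
--    proper one consists of the even rotations and one coset of reflections,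
--    so it is the kernel of one of the two characters χ_b : Dₙ → ℤ/2ℤ
--    (`proper-normal-reflection⇒Kχ`), adding 2 to the count.

open import Data.Bool using (Bool; true)
import Data.Bool.Properties as Bool
open import Data.Empty using (⊥; ⊥-elim; ⊥-elim-irr)
open import Data.Fin as Fin using (Fin; toℕ; fromℕ<)
open import Data.Fin.Properties using (toℕ-fromℕ<; toℕ-injective; toℕ<n; any?; +↔⊎)
open import Data.Fin.Subset using () renaming (_∈_ to _∈ₛ_)
open import Data.Fin.Subset.Properties using (⊆-antisym) renaming (_∈?_ to _∈ₛ?_)
open import Data.List using (List; []; _∷_; _++_; length; filter; map; upTo; lookup)
open import Data.List.Properties using (upTo-∷ʳ; map-++; filter-++; length-++; filter-accept)
open import Data.List.Membership.Propositional using () renaming (_∈_ to _∈ˡ_)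
open import Data.List.Membership.Propositional.Properties
  using (∈-lookup; ∈-filter⁻; ∈-filter⁺; ∈-map⁻; ∈-map⁺; ∈-upTo⁻; ∈-upTo⁺)
import Data.List.Relation.Unary.All as All
import Data.List.Relation.Unary.Any as Any
open import Data.List.Relation.Unary.Any.Properties using (lookup-index)
open import Data.List.Relation.Unary.Unique.Propositional using (Unique; _∷_)
import Data.List.Relation.Unary.Unique.Propositional.Properties as Uniqueₚ
open import Data.Nat
  using (ℕ; zero; suc; pred; NonZero; _≤_; _<_; _+_; _∸_; _*_; z≤n; s≤s; parity; >-nonZero⁻¹)
open import Data.Nat.Divisibility
  using (_∣_; _∣?_; divides; ∣-refl; ∣-antisym; ∣⇒≤; _∣0; ∣m∣n⇒∣m+n; ∣m+n∣m⇒∣n;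
         m%n≡0⇒n∣m; n∣m⇒m%n≡0; %-presˡ-∣)
open import Data.Nat.DivMod
  using (_%_; _/_; m≡m%n+[m/n]*n; m%n<n; m<n⇒m%n≡m; n%n≡0; %-distribˡ-+)
open import Data.Nat.Properties
  using (1+n≰n; 0≢1+n; suc-injective; suc-pred; ≤-pred; <⇒≤; m≤n⇒m<n∨m≡n; m<1+n⇒m<n∨m≡n;
         +-comm; +-assoc; +-identityʳ; +-suc; *-comm; m∸n+n≡m; m+[n∸m]≡n; m+n∸n≡m)
open import Data.Parity.Base as ℙ using (Parity; 0ℙ; 1ℙ)
import Data.Parity.Properties as ℙₚ
open import Data.Parity.Properties using (+-homo-+; *-homo-*)
open import Data.Product using (_×_; _,_; proj₁; proj₂; ∃-syntax)
open import Data.Product.Properties using () renaming (≡-dec to ×-≡-dec)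
open import Data.Sum using (_⊎_; inj₁; inj₂)
open import Data.Sum.Function.Propositional using (_⊎-↔_)
open import Data.Unit using (tt)
open import Data.Vec using (tabulate)
open import Data.Vec.Properties
  using (lookup∘tabulate; []=⇒lookup; lookup⇒[]=) renaming (≡-dec to Vec-≡-dec)
open import Algebra.Bundles using (Group; AbelianGroup)
open import Function.Base using (_∘_)
open import Function.Bundles using (_⇔_; mk⇔; Equivalence; _↔_; mk↔ₛ′; Inverse)
open import Function.Properties.Equivalence using () renaming (trans to ⇔-trans; sym to ⇔-sym)
open import Function.Properties.Inverse using (↔-refl; ↔-trans)
open import Level using (0ℓ)
open import Relation.Binary.PropositionalEquality hiding ([_])
open import Relation.Nullary using (¬_; Dec; yes; no; does)

open import Defs

even⇒double : ∀ a → parity a ≡ 0ℙ → ∃[ t ] a ≡ t + t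
even⇒double zero _ = 0 , refl
even⇒double (suc (suc a)) p with even⇒double a p
... | t , refl = suc t , cong suc (sym (+-suc t t))

2∣⇒even : ∀ {a} → 2 ∣ a → parity a ≡ 0ℙ
2∣⇒even {.(q * 2)} (divides q refl) = trans (*-homo-* q 2) (ℙₚ.*-zeroʳ (parity q))

¬2∣⇒odd : ∀ {a} → ¬ 2 ∣ a → parity a ≡ 1ℙ
¬2∣⇒odd {a} ¬2∣a with parity a in p
... | 1ℙ = refl
... | 0ℙ with even⇒double a p
...   | t , a≡t+t = ⊥-elim (¬2∣a (divides t (trans a≡t+t t+t≡t*2)))
  where
  t+t≡t*2 : t + t ≡ t * 2
  t+t≡t*2 = trans (cong (t +_) (sym (+-identityʳ t))) (*-comm 2 t)

Least : (ℕ → Set) → Set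
Least P = ∃[ d ] P d × (∀ c → c < d → ¬ P c)

module _ {P : ℕ → Set} (P? : ∀ c → Dec (P c)) where

  least-from : ∀ k c → (∀ c′ → c′ < c → ¬ P c′) → P (c + k) → Least P
  least-from zero c below p = c , subst P (+-identityʳ c) p , below
  least-from (suc k) c below p with P? c
  ... | yes pc = c , pc , below
  ... | no ¬pc = least-from k (suc c) below′ (subst P (+-suc c k) p)
    where
    below′ : ∀ c′ → c′ < suc c → ¬ P c′
    below′ c′ c′<1+c with m<1+n⇒m<n∨m≡n c′<1+c
    ... | inj₁ c′<c  = below c′ c′<c
    ... | inj₂ refl = ¬pc

  least : ∀ {m} → P m → Least P
  least {m} = least-from m 0 (λ _ ())

lookup-injective : ∀ {A : Set} {xs : List A} → Unique xs →
                   ∀ i j → lookup xs i ≡ lookup xs j → i ≡ j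
lookup-injective (_ ∷ _) Fin.zero Fin.zero _ = refl
lookup-injective (x∉ ∷ _) Fin.zero (Fin.suc j) eq = ⊥-elim (All.lookup x∉ (∈-lookup j) eq)
lookup-injective (x∉ ∷ _) (Fin.suc i) Fin.zero eq = ⊥-elim (All.lookup x∉ (∈-lookup i) (sym eq))
lookup-injective (_ ∷ uniq) (Fin.suc i) (Fin.suc j) eq = cong Fin.suc (lookup-injective uniq i j eq)

properDivisors : ℕ → List ℕ
properDivisors n = filter (_∣? n) (map suc (upTo (pred n)))

∈-properDivisors : ∀ {n d} → d ∈ˡ properDivisors n ⇔ (d ∣ n × 1 ≤ d × d < n)
∈-properDivisors {zero} = mk⇔ (λ ()) (λ ())
∈-properDivisors {suc m} {d} = mk⇔ out into
  where
  out : d ∈ˡ properDivisors (suc m) → d ∣ suc m × 1 ≤ d × d < suc m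
  out d∈ with ∈-filter⁻ (_∣? suc m) {xs = map suc (upTo m)} d∈
  ... | d∈map , d∣n with ∈-map⁻ suc {xs = upTo m} d∈map
  ...   | c , c∈ , refl = d∣n , s≤s z≤n , s≤s (∈-upTo⁻ c∈)
  into : d ∣ suc m × 1 ≤ d × d < suc m → d ∈ˡ properDivisors (suc m)
  into (d∣n , s≤s z≤n , s≤s c<m) = ∈-filter⁺ (_∣? suc m) (∈-map⁺ suc (∈-upTo⁺ c<m)) d∣n

properDivisors-unique : ∀ n → Unique (properDivisors n)
properDivisors-unique n =
  Uniqueₚ.filter⁺ (_∣? n) (Uniqueₚ.map⁺ suc-injective (Uniqueₚ.upTo⁺ (pred n)))

τ≡properDivisors+1 : ∀ n .{{_ : NonZero n}} → τ n ≡ length (properDivisors n) + 1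
τ≡properDivisors+1 (suc m) = begin
  length (filter P? (map suc (upTo (suc m))))
    ≡⟨ cong (λ xs → length (filter P? (map suc xs))) (upTo-∷ʳ m) ⟨
  length (filter P? (map suc (upTo m ++ m ∷ [])))
    ≡⟨ cong (length ∘ filter P?) (map-++ suc (upTo m) (m ∷ [])) ⟩
  length (filter P? (map suc (upTo m) ++ suc m ∷ []))
    ≡⟨ cong length (filter-++ P? (map suc (upTo m)) (suc m ∷ [])) ⟩
  length (properDivisors (suc m) ++ filter P? (suc m ∷ []))
    ≡⟨ length-++ (properDivisors (suc m)) ⟩
  length (properDivisors (suc m)) + length (filter P? (suc m ∷ []))
    ≡⟨ cong (λ xs → length (properDivisors (suc m)) + length xs) (filter-accept P? {xs = []} ∣-refl) ⟩
  length (properDivisors (suc m)) + 1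
    ∎
  where
  open ≡-Reasoning
  P? : ∀ d → Dec (d ∣ suc m)
  P? = _∣? suc m

module _ {n : ℕ} .{{_ : NonZero n}} where

  infixl 6 _+ₙ_
  _+ₙ_ : Fin n → Fin n → Fin n
  _+ₙ_ = _⊕_ n

  -ₙ_ : Fin n → Fin n
  -ₙ_ = ⊝_ n

  0ₙ : Fin n
  0ₙ = zeroF n

  -- the residue of a natural number; note that i +ₙ j is [ toℕ i + toℕ j ],
  -- -ₙ i is [ n ∸ toℕ i ] and 0ₙ is [ 0 ] by definition
  [_] : ℕ → Fin n
  [ a ] = fromℕ< (m%n<n a n)

  toℕ-[] : ∀ a → toℕ [ a ] ≡ a % n
  toℕ-[] a = toℕ-fromℕ< _

  toℕ-[]< : ∀ {a} → a < n → toℕ [ a ] ≡ a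
  toℕ-[]< a<n = trans (toℕ-[] _) (m<n⇒m%n≡m a<n)

  toℕ-0ₙ : toℕ 0ₙ ≡ 0
  toℕ-0ₙ = toℕ-[]< (>-nonZero⁻¹ n)

  []-toℕ : ∀ i → [ toℕ i ] ≡ i
  []-toℕ i = toℕ-injective (toℕ-[]< (toℕ<n i))

  []-+ : ∀ a b → [ a ] +ₙ [ b ] ≡ [ a + b ]
  []-+ a b = toℕ-injective (begin
    toℕ ([ a ] +ₙ [ b ])                ≡⟨ toℕ-[] _ ⟩
    (toℕ [ a ] + toℕ [ b ]) % n         ≡⟨ cong₂ (λ x y → (x + y) % n) (toℕ-[] a) (toℕ-[] b) ⟩
    (a % n + b % n) % n                 ≡⟨ %-distribˡ-+ a b n ⟨
    (a + b) % n                         ≡⟨ toℕ-[] (a + b) ⟨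
    toℕ [ a + b ]                       ∎)
    where open ≡-Reasoning

  []-n : [ n ] ≡ 0ₙ
  []-n = toℕ-injective (trans (toℕ-[] n) (trans (n%n≡0 n) (sym toℕ-0ₙ)))

  +ₙ-assoc : ∀ i j k → (i +ₙ j) +ₙ k ≡ i +ₙ (j +ₙ k)
  +ₙ-assoc i j k = begin
    [ toℕ i + toℕ j ] +ₙ k           ≡⟨ cong ([ toℕ i + toℕ j ] +ₙ_) ([]-toℕ k) ⟨
    [ toℕ i + toℕ j ] +ₙ [ toℕ k ]   ≡⟨ []-+ (toℕ i + toℕ j) (toℕ k) ⟩
    [ toℕ i + toℕ j + toℕ k ]        ≡⟨ cong [_] (+-assoc (toℕ i) (toℕ j) (toℕ k)) ⟩
    [ toℕ i + (toℕ j + toℕ k) ]      ≡⟨ []-+ (toℕ i) (toℕ j + toℕ k) ⟨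
    [ toℕ i ] +ₙ (j +ₙ k)            ≡⟨ cong (_+ₙ (j +ₙ k)) ([]-toℕ i) ⟩
    i +ₙ (j +ₙ k)                    ∎
    where open ≡-Reasoning

  +ₙ-comm : ∀ i j → i +ₙ j ≡ j +ₙ i
  +ₙ-comm i j = cong [_] (+-comm (toℕ i) (toℕ j))

  +ₙ-identityˡ : ∀ i → 0ₙ +ₙ i ≡ i
  +ₙ-identityˡ i = trans (cong (0ₙ +ₙ_) (sym ([]-toℕ i))) (trans ([]-+ 0 (toℕ i)) ([]-toℕ i))

  +ₙ-identityʳ : ∀ i → i +ₙ 0ₙ ≡ i
  +ₙ-identityʳ i = trans (+ₙ-comm i 0ₙ) (+ₙ-identityˡ i)

  +ₙ-inverseˡ : ∀ i → (-ₙ i) +ₙ i ≡ 0ₙ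
  +ₙ-inverseˡ i = begin
    [ n ∸ toℕ i ] +ₙ i           ≡⟨ cong ([ n ∸ toℕ i ] +ₙ_) ([]-toℕ i) ⟨
    [ n ∸ toℕ i ] +ₙ [ toℕ i ]   ≡⟨ []-+ (n ∸ toℕ i) (toℕ i) ⟩
    [ n ∸ toℕ i + toℕ i ]        ≡⟨ cong [_] (m∸n+n≡m (<⇒≤ (toℕ<n i))) ⟩
    [ n ]                        ≡⟨ []-n ⟩
    0ₙ                           ∎
    where open ≡-Reasoning

  +ₙ-inverseʳ : ∀ i → i +ₙ (-ₙ i) ≡ 0ₙ
  +ₙ-inverseʳ i = trans (+ₙ-comm i (-ₙ i)) (+ₙ-inverseˡ i)

  ℤ/n : AbelianGroup 0ℓ 0ℓ
  ℤ/n = record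
    { Carrier = Fin n ; _≈_ = _≡_ ; _∙_ = _+ₙ_ ; ε = 0ₙ ; _⁻¹ = -ₙ_
    ; isAbelianGroup = record
      { isGroup = record
        { isMonoid = record
          { isSemigroup = record
            { isMagma = record { isEquivalence = isEquivalence ; ∙-cong = cong₂ _+ₙ_ }
            ; assoc = +ₙ-assoc }
          ; identity = +ₙ-identityˡ , +ₙ-identityʳ }
        ; inverse = +ₙ-inverseˡ , +ₙ-inverseʳ
        ; ⁻¹-cong = cong -ₙ_ }
      ; comm = +ₙ-comm } }

  open import Algebra.Properties.AbelianGroup ℤ/n
    using () renaming (⁻¹-∙-comm to -ₙ-distrib; ⁻¹-involutive to -ₙ-involutive;
                       ε⁻¹≈ε to -ₙ0≡0; xyx⁻¹≈y to +ₙ-conjugate;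
                       //-rightDividesˡ to sub-add-cancel; //-rightDividesʳ to add-sub-cancel) public

  -- subtraction identities needed for associativity in Dₙ
  sub-sub : ∀ i j k → (i +ₙ -ₙ j) +ₙ -ₙ k ≡ i +ₙ -ₙ (j +ₙ k)
  sub-sub i j k = trans (+ₙ-assoc i (-ₙ j) (-ₙ k)) (cong (i +ₙ_) (-ₙ-distrib j k))

  sub-add : ∀ i j k → (i +ₙ -ₙ j) +ₙ k ≡ i +ₙ -ₙ (j +ₙ -ₙ k)
  sub-add i j k = begin
    (i +ₙ -ₙ j) +ₙ k          ≡⟨ +ₙ-assoc i (-ₙ j) k ⟩
    i +ₙ (-ₙ j +ₙ k)          ≡⟨ cong (λ x → i +ₙ (-ₙ j +ₙ x)) (-ₙ-involutive k) ⟨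
    i +ₙ (-ₙ j +ₙ -ₙ -ₙ k)    ≡⟨ cong (i +ₙ_) (-ₙ-distrib j (-ₙ k)) ⟩
    i +ₙ -ₙ (j +ₙ -ₙ k)       ∎
    where open ≡-Reasoning

  -- exponent of the rotation (aᵃ · aᵏb · a⁻ᵃ) · aᵏb
  conjugate-twice : ∀ a k → ((a +ₙ k) +ₙ -ₙ -ₙ a) +ₙ -ₙ k ≡ a +ₙ a
  conjugate-twice a k = begin
    ((a +ₙ k) +ₙ -ₙ -ₙ a) +ₙ -ₙ k   ≡⟨ cong (λ x → ((a +ₙ k) +ₙ x) +ₙ -ₙ k) (-ₙ-involutive a) ⟩
    ((a +ₙ k) +ₙ a) +ₙ -ₙ k         ≡⟨ cong (_+ₙ -ₙ k) (+ₙ-assoc a k a) ⟩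
    (a +ₙ (k +ₙ a)) +ₙ -ₙ k         ≡⟨ cong (λ x → (a +ₙ x) +ₙ -ₙ k) (+ₙ-comm k a) ⟩
    (a +ₙ (a +ₙ k)) +ₙ -ₙ k         ≡⟨ cong (_+ₙ -ₙ k) (+ₙ-assoc a a k) ⟨
    ((a +ₙ a) +ₙ k) +ₙ -ₙ k         ≡⟨ add-sub-cancel k (a +ₙ a) ⟩
    a +ₙ a                          ∎
    where open ≡-Reasoning

-- The dihedral group Dₙ

module _ {n : ℕ} .{{_ : NonZero n}} where

  rot-injective : ∀ {i j : Fin n} → rot i ≡ rot j → i ≡ j
  rot-injective refl = refl

  ·-assoc : ∀ (x y z : Dih n) → (x · y) · z ≡ x · (y · z)
  ·-assoc (rot i) (rot j) (rot k) = cong rot (+ₙ-assoc i j k)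
  ·-assoc (rot i) (rot j) (ref k) = cong ref (+ₙ-assoc i j k)
  ·-assoc (rot i) (ref j) (rot k) = cong ref (+ₙ-assoc i j (-ₙ k))
  ·-assoc (rot i) (ref j) (ref k) = cong rot (+ₙ-assoc i j (-ₙ k))
  ·-assoc (ref i) (rot j) (rot k) = cong ref (sub-sub i j k)
  ·-assoc (ref i) (rot j) (ref k) = cong rot (sub-sub i j k)
  ·-assoc (ref i) (ref j) (rot k) = cong rot (sub-add i j k)
  ·-assoc (ref i) (ref j) (ref k) = cong ref (sub-add i j k)

  ·-identityˡ : ∀ (x : Dih n) → e · x ≡ x
  ·-identityˡ (rot i) = cong rot (+ₙ-identityˡ i)
  ·-identityˡ (ref i) = cong ref (+ₙ-identityˡ i)

  ·-identityʳ : ∀ (x : Dih n) → x · e ≡ x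
  ·-identityʳ (rot i) = cong rot (+ₙ-identityʳ i)
  ·-identityʳ (ref i) = cong ref (trans (cong (i +ₙ_) -ₙ0≡0) (+ₙ-identityʳ i))

  ·-inverseˡ : ∀ (x : Dih n) → inv x · x ≡ e
  ·-inverseˡ (rot i) = cong rot (+ₙ-inverseˡ i)
  ·-inverseˡ (ref i) = cong rot (+ₙ-inverseʳ i)

  ·-inverseʳ : ∀ (x : Dih n) → x · inv x ≡ e
  ·-inverseʳ (rot i) = cong rot (+ₙ-inverseʳ i)
  ·-inverseʳ (ref i) = ·-inverseˡ (ref i)

  Dₙ : Group 0ℓ 0ℓ
  Dₙ = record
    { Carrier = Dih n ; _≈_ = _≡_ ; _∙_ = _·_ ; ε = e ; _⁻¹ = inv
    ; isGroup = record
      { isMonoid = record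
        { isSemigroup = record
          { isMagma = record { isEquivalence = isEquivalence ; ∙-cong = cong₂ _·_ }
          ; assoc = ·-assoc }
        ; identity = ·-identityˡ , ·-identityʳ }
      ; inverse = ·-inverseˡ , ·-inverseʳ
      ; ⁻¹-cong = cong inv } }

  open import Algebra.Properties.Group Dₙ
    using (\\-leftDividesˡ; //-rightDividesˡ) renaming (⁻¹-involutive to inv-involutive) public

does⇔ : ∀ {A : Set} (a? : Dec A) → (does a? ≡ true) ⇔ A
does⇔ (yes a) = mk⇔ (λ _ → a) (λ _ → refl)
does⇔ (no ¬a) = mk⇔ (λ ()) (λ a → ⊥-elim (¬a a))

module _ {n : ℕ} where

  SubD-ext : ∀ {H K : SubD n} →
             (∀ x → x ∈ H → x ∈ K) → (∀ x → x ∈ K → x ∈ H) → H ≡ K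
  SubD-ext {R , F} {R′ , F′} H⊆K K⊆H =
    cong₂ _,_ (⊆-antisym (λ {k} → H⊆K (rot k)) (λ {k} → K⊆H (rot k)))
              (⊆-antisym (λ {k} → H⊆K (ref k)) (λ {k} → K⊆H (ref k)))

  ∈-tabulate : (f : Fin n → Bool) (k : Fin n) → k ∈ₛ tabulate f ⇔ f k ≡ true
  ∈-tabulate f k = mk⇔ (λ k∈ → trans (sym (lookup∘tabulate f k)) ([]=⇒lookup k∈))
                       (λ fk → lookup⇒[]= k (tabulate f) (trans (lookup∘tabulate f k) fk))

  ⟦_⟧ : {P : Dih n → Set} → (∀ x → Dec (P x)) → SubD n
  ⟦ P? ⟧ = tabulate (λ k → does (P? (rot k))) , tabulate (λ k → does (P? (ref k)))

  ∈⟦⟧ : {P : Dih n → Set} (P? : ∀ x → Dec (P x)) (x : Dih n) → x ∈ ⟦ P? ⟧ ⇔ P x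
  ∈⟦⟧ {P} P? (rot k) = ⇔-trans (∈-tabulate _ k) (does⇔ (P? (rot k)))
  ∈⟦⟧ {P} P? (ref k) = ⇔-trans (∈-tabulate _ k) (does⇔ (P? (ref k)))


module _ {n : ℕ} .{{_ : NonZero n}} where

  -- a normal subset permutes with every subset, since
  -- h k = k (k⁻¹ h k) and k h = (k h k⁻¹) k
  normal⇒permutable : ∀ {H} → IsNormal H → ∀ K → Permutable H K
  normal⇒permutable {H} H◁ K x = mk⇔
    (λ { (h , k , h∈ , k∈ , refl) →
           k , (inv k · h) · inv (inv k) , k∈ , H◁ (inv k) h h∈ , hk≡ h k })
    (λ { (k , h , k∈ , h∈ , refl) →
           (k · h) · inv k , k , H◁ k h h∈ , k∈ , sym (//-rightDividesˡ k (k · h)) })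
    where
    hk≡ : ∀ h k → h · k ≡ k · ((inv k · h) · inv (inv k))
    hk≡ h k = begin
      h · k                          ≡⟨ \\-leftDividesˡ k (h · k) ⟨
      k · (inv k · (h · k))          ≡⟨ cong (k ·_) (·-assoc (inv k) h k) ⟨
      k · ((inv k · h) · k)          ≡⟨ cong (λ y → k · ((inv k · h) · y)) (inv-involutive k) ⟨
      k · ((inv k · h) · inv (inv k)) ∎
      where open ≡-Reasoning

  permutable-sym : ∀ {H K : SubD n} → Permutable H K → Permutable K H
  permutable-sym HK x = ⇔-sym (HK x)

  trivial⇒normal : ∀ {H} → IsTrivial H → IsNormal H
  trivial⇒normal {H} H≡1 g h h∈ = Equivalence.from (H≡1 _) (begin
    (g · h) · inv g   ≡⟨ cong (λ y → (g · y) · inv g) (Equivalence.to (H≡1 h) h∈) ⟩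
    (g · e) · inv g   ≡⟨ cong (_· inv g) (·-identityʳ g) ⟩
    g · inv g         ≡⟨ ·-inverseʳ g ⟩
    e                 ∎)
    where open ≡-Reasoning

  _∈?_ : (x : Dih n) (H : SubD n) → Dec (x ∈ H)
  rot k ∈? (R , F) = k ∈ₛ? R
  ref k ∈? (R , F) = k ∈ₛ? F

  _≟ˢ_ : (H K : SubD n) → Dec (H ≡ K)
  _≟ˢ_ = ×-≡-dec (Vec-≡-dec Bool._≟_) (Vec-≡-dec Bool._≟_)

record NormalEnumeration (n : ℕ) .{{_ : NonZero n}} (I : Set) : Set where
  field
    subgroupAt : I → SubD n
    injective  : ∀ i j → subgroupAt i ≡ subgroupAt j → i ≡ j
    subgroup   : ∀ i → IsSubgroup (subgroupAt i)
    normal     : ∀ i → IsNormal (subgroupAt i)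
    nontrivial : ∀ i → ¬ IsTrivial (subgroupAt i)
    proper     : ∀ i → ¬ IsWhole (subgroupAt i)
    complete   : ∀ H → IsSubgroup H → IsNormal H → ¬ IsTrivial H → ¬ IsWhole H →
                 ∃[ i ] subgroupAt i ≡ H

reindex : ∀ {n} .{{_ : NonZero n}} {I J : Set} →
          J ↔ I → NormalEnumeration n I → NormalEnumeration n J
reindex {J = J} J↔I E = record
  { subgroupAt = subgroupAt ∘ to
  ; injective  = λ i j eq → to-injective (injective (to i) (to j) eq)
  ; subgroup   = subgroup ∘ to
  ; normal     = normal ∘ to
  ; nontrivial = nontrivial ∘ to
  ; proper     = proper ∘ to
  ; complete   = λ H s H◁ t w → let (i , eq) = complete H s H◁ t w
                                in from i , trans (cong subgroupAt (strictlyInverseˡ i)) eq }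
  where
  open NormalEnumeration E
  open Inverse J↔I
  to-injective : ∀ {i j : J} → to i ≡ to j → i ≡ j
  to-injective {i} {j} eq = trans (sym (strictlyInverseʳ i)) (trans (cong from eq) (strictlyInverseʳ j))

-- An enumeration by Fin r identifies Γ(Dₙ) with K_r + Γ_N(Dₙ): the listed
-- subgroups are normal, hence permute with every subgroup and form a clique
-- joined to all other vertices; every unlisted vertex is a proper non-normal
-- subgroup, i.e. a vertex of Γ_N(Dₙ), with the same adjacency.
module _ {n : ℕ} .{{_ : NonZero n}} {r : ℕ} (E : NormalEnumeration n (Fin r)) where
  open NormalEnumeration E

  private
    listed? : (H : SubD n) → Dec (∃[ i ] subgroupAt i ≡ H)
    listed? H = any? (λ i → subgroupAt i ≟ˢ H)

    to : ΓVertex n → V (K r ⊞ ΓN n)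
    to (γv H s t w) with listed? H
    ... | yes (i , _)  = inj₁ i
    ... | no unlisted = inj₂ (γnv H s w (λ H◁ → unlisted (complete H s H◁ t w)))

    from : V (K r ⊞ ΓN n) → ΓVertex n
    from (inj₁ i)              = γv (subgroupAt i) (subgroup i) (nontrivial i) (proper i)
    from (inj₂ (γnv H s w ¬◁)) = γv H s (λ H≡1 → ¬◁ (trivial⇒normal H≡1)) w

    from∘to : ∀ x → from (to x) ≡ x
    from∘to (γv H s t w) with listed? H
    ... | yes (i , refl) = refl
    ... | no _           = refl

    to∘from : ∀ y → to (from y) ≡ y
    to∘from (inj₁ i) with listed? (subgroupAt i)
    ... | yes (j , eq)  = cong inj₁ (injective j i eq)
    ... | no unlisted   = ⊥-elim (unlisted (i , refl))
    to∘from (inj₂ (γnv H s w ¬◁)) with listed? H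
    ... | yes (i , refl) = ⊥-elim-irr (¬◁ (normal i))
    ... | no _           = refl

    adjacent : ∀ x y → Adj (Γ n) x y ⇔ Adj (K r ⊞ ΓN n) (to x) (to y)
    adjacent (γv H s t w) (γv H′ s′ t′ w′) with listed? H | listed? H′
    ... | yes (i , refl) | yes (j , refl) =
      mk⇔ (λ (Hᵢ≢Hⱼ , _) i≡j → Hᵢ≢Hⱼ (cong subgroupAt i≡j))
          (λ i≢j → (λ eq → i≢j (injective i j eq)) , normal⇒permutable (normal i) _)
    ... | yes (i , refl) | no unlisted =
      mk⇔ (λ _ → tt) (λ _ → (λ eq → unlisted (i , eq)) , normal⇒permutable (normal i) _)
    ... | no unlisted | yes (j , refl) =
      mk⇔ (λ _ → tt)
          (λ _ → (λ eq → unlisted (j , sym eq)) , permutable-sym (normal⇒permutable (normal j) _))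
    ... | no _ | no _ = mk⇔ (λ a → a) (λ a → a)

  Γ≅K⊞ΓN : Γ n ≅ (K r ⊞ ΓN n)
  Γ≅K⊞ΓN = record
    { to = to ; from = from ; from∘to = from∘to ; to∘from = to∘from ; adj = adjacent }

-- Rotation subgroups ⟨aᵈ⟩ = { aᵏ : d ∣ k } for divisors d of n

∣-∸ : ∀ {d m k} → d ∣ m → d ∣ k → k ≤ m → d ∣ m ∸ k
∣-∸ {d} {m} {k} d∣m d∣k k≤m = ∣m+n∣m⇒∣n (subst (d ∣_) (sym (m+[n∸m]≡n k≤m)) d∣m) d∣k

module _ {n : ℕ} .{{_ : NonZero n}} where

  RotMultiple : ℕ → Dih n → Set
  RotMultiple d (rot k) = d ∣ toℕ k
  RotMultiple d (ref k) = ⊥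

  RotMultiple? : ∀ d x → Dec (RotMultiple d x)
  RotMultiple? d (rot k) = d ∣? toℕ k
  RotMultiple? d (ref k) = no (λ ())

  ⟨a^_⟩ : ℕ → SubD n
  ⟨a^ d ⟩ = ⟦ RotMultiple? d ⟧

  ∈⟨a^⟩ : ∀ d x → x ∈ ⟨a^ d ⟩ ⇔ RotMultiple d x
  ∈⟨a^⟩ d = ∈⟦⟧ (RotMultiple? d)

  aᵈ∈⟨a^d⟩ : ∀ {d} → d < n → rot [ d ] ∈ ⟨a^ d ⟩
  aᵈ∈⟨a^d⟩ {d} d<n =
    Equivalence.from (∈⟨a^⟩ d (rot [ d ])) (subst (d ∣_) (sym (toℕ-[]< d<n)) ∣-refl)

  conjugate-rot : ∀ g a → ((g · rot a) · inv g ≡ rot a) ⊎ ((g · rot a) · inv g ≡ rot (-ₙ a))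
  conjugate-rot (rot c) a = inj₁ (cong rot (+ₙ-conjugate c a))
  conjugate-rot (ref c) a = inj₂ (cong rot (+ₙ-conjugate c (-ₙ a)))

  module _ {d : ℕ} (d∣n : d ∣ n) where

    private
      ∣-[] : ∀ {a} → d ∣ a → d ∣ toℕ [ a ]
      ∣-[] d∣a = subst (d ∣_) (sym (toℕ-[] _)) (%-presˡ-∣ d∣a d∣n)

      into : ∀ {x} → RotMultiple d x → x ∈ ⟨a^ d ⟩
      into = Equivalence.from (∈⟨a^⟩ d _)

      out : ∀ {x} → x ∈ ⟨a^ d ⟩ → RotMultiple d x
      out = Equivalence.to (∈⟨a^⟩ d _)

      -ₙ-∈ : ∀ a → rot a ∈ ⟨a^ d ⟩ → rot (-ₙ a) ∈ ⟨a^ d ⟩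
      -ₙ-∈ a a∈ = into (∣-[] (∣-∸ d∣n (out a∈) (<⇒≤ (toℕ<n a))))

    ⟨a^⟩-subgroup : IsSubgroup ⟨a^ d ⟩
    ⟨a^⟩-subgroup = record { one∈ = into (∣-[] (d ∣0)) ; mul∈ = mul∈ ; inv∈ = inv∈ }
      where
      mul∈ : ∀ x y → x ∈ ⟨a^ d ⟩ → y ∈ ⟨a^ d ⟩ → (x · y) ∈ ⟨a^ d ⟩
      mul∈ (rot a) (rot b) a∈ b∈ = into (∣-[] (∣m∣n⇒∣m+n (out a∈) (out b∈)))
      mul∈ (rot a) (ref b) _ b∈ = ⊥-elim (out b∈)
      mul∈ (ref a) _ a∈ _ = ⊥-elim (out a∈)
      inv∈ : ∀ x → x ∈ ⟨a^ d ⟩ → inv x ∈ ⟨a^ d ⟩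
      inv∈ (rot a) a∈ = -ₙ-∈ a a∈
      inv∈ (ref a) a∈ = ⊥-elim (out a∈)

    ⟨a^⟩-normal : IsNormal ⟨a^ d ⟩
    ⟨a^⟩-normal g (rot a) a∈ with conjugate-rot g a
    ... | inj₁ eq = subst (_∈ ⟨a^ d ⟩) (sym eq) a∈
    ... | inj₂ eq = subst (_∈ ⟨a^ d ⟩) (sym eq) (-ₙ-∈ a a∈)
    ⟨a^⟩-normal g (ref a) a∈ = ⊥-elim (out a∈)

    ⟨a^⟩-proper : ¬ IsWhole ⟨a^ d ⟩
    ⟨a^⟩-proper whole = out (whole (ref 0ₙ))

    -- aᵈ itself is a nonidentity element when 0 < d < n
    ⟨a^⟩-nontrivial : 1 ≤ d → d < n → ¬ IsTrivial ⟨a^ d ⟩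
    ⟨a^⟩-nontrivial 1≤d d<n trivial = 1+n≰n (subst (1 ≤_) d≡0 1≤d)
      where
      d≡0 : d ≡ 0
      d≡0 = begin
        d              ≡⟨ toℕ-[]< d<n ⟨
        toℕ [ d ]      ≡⟨ cong toℕ (rot-injective aᵈ≡e) ⟩
        toℕ 0ₙ         ≡⟨ toℕ-0ₙ ⟩
        0              ∎
        where
        open ≡-Reasoning
        aᵈ≡e : rot [ d ] ≡ e
        aᵈ≡e = Equivalence.to (trivial (rot [ d ])) (aᵈ∈⟨a^d⟩ d<n)

  -- distinct divisors below n give distinct rotation subgroups, since
  -- aᵈ ∈ ⟨aᵈ′⟩ means d′ ∣ d
  ⟨a^⟩-injective : ∀ {d d′} → d < n → d′ < n → ⟨a^ d ⟩ ≡ ⟨a^ d′ ⟩ → d ≡ d′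
  ⟨a^⟩-injective d<n d′<n eq = ∣-antisym (divides-other d′<n (sym eq)) (divides-other d<n eq)
    where
    divides-other : ∀ {c c′} → c < n → ⟨a^ c ⟩ ≡ ⟨a^ c′ ⟩ → c′ ∣ c
    divides-other {c} {c′} c<n eq = subst (c′ ∣_) (toℕ-[]< c<n)
      (Equivalence.to (∈⟨a^⟩ c′ (rot [ c ])) (subst (rot [ c ] ∈_) eq (aᵈ∈⟨a^d⟩ c<n)))

-- Arithmetic inside a subgroup H of Dₙ, with rotations aᵃ written through
-- representatives a ∈ ℕ

module _ {n : ℕ} .{{_ : NonZero n}} {H : SubD n} (H≤ : IsSubgroup H) where
  open IsSubgroup H≤

  rot∈-cong : ∀ {i j} → i ≡ j → rot i ∈ H → rot j ∈ H
  rot∈-cong = subst (λ i → rot i ∈ H)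

  rot-toℕ : ∀ k → rot k ∈ H ⇔ rot [ toℕ k ] ∈ H
  rot-toℕ k = mk⇔ (rot∈-cong (sym ([]-toℕ k))) (rot∈-cong ([]-toℕ k))

  rot-+ : ∀ a b → rot [ a ] ∈ H → rot [ b ] ∈ H → rot [ a + b ] ∈ H
  rot-+ a b a∈ b∈ = rot∈-cong ([]-+ a b) (mul∈ (rot [ a ]) (rot [ b ]) a∈ b∈)

  rot-∸ : ∀ a b → rot [ a + b ] ∈ H → rot [ b ] ∈ H → rot [ a ] ∈ H
  rot-∸ a b a+b∈ b∈ =
    rot∈-cong a+b-b≡a (mul∈ (rot [ a + b ]) (rot (-ₙ [ b ])) a+b∈ (inv∈ (rot [ b ]) b∈))
    where
    a+b-b≡a : [ a + b ] +ₙ -ₙ [ b ] ≡ [ a ]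
    a+b-b≡a = trans (cong (_+ₙ -ₙ [ b ]) (sym ([]-+ a b))) (add-sub-cancel [ b ] [ a ])

  rot-n : rot [ n ] ∈ H
  rot-n = rot∈-cong (sym []-n) one∈

  rot-multiple : ∀ d q → rot [ d ] ∈ H → rot [ q * d ] ∈ H
  rot-multiple d zero    _  = one∈
  rot-multiple d (suc q) d∈ = rot-+ d (q * d) d∈ (rot-multiple d q d∈)

  reflection-coset : ∀ {k₀} → ref k₀ ∈ H → ∀ k → ref k ∈ H ⇔ rot (k +ₙ -ₙ k₀) ∈ H
  reflection-coset {k₀} k₀∈ k = mk⇔
    (λ k∈ → mul∈ (ref k) (ref k₀) k∈ k₀∈)
    (λ k-k₀∈ → subst (λ i → ref i ∈ H) (sub-add-cancel k₀ k)
                 (mul∈ (rot (k +ₙ -ₙ k₀)) (ref k₀) k-k₀∈ k₀∈))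

  all-rotations⇒whole : ∀ {k₀} → ref k₀ ∈ H → (∀ k → rot k ∈ H) → IsWhole H
  all-rotations⇒whole k₀∈ all (rot k) = all k
  all-rotations⇒whole k₀∈ all (ref k) = Equivalence.from (reflection-coset k₀∈ k) (all _)

  -- The rotations of H are the powers of aᵈ, where d is the least positive
  -- exponent with aᵈ ∈ H (it exists since aⁿ = 1): the residue r of an
  -- exponent modulo d is again an exponent, so r = 0 by minimality.
  rotation-part : ∃[ d ] d ∣ n × 1 ≤ d × (∀ k → rot k ∈ H ⇔ d ∣ toℕ k)
  rotation-part with least (λ c → rot [ suc c ] ∈? H) (rot∈-cong (cong [_] (sym (suc-pred n))) rot-n)
  ... | d′ , d∈ , below =
    d , d∣ n rot-n , s≤s z≤n , λ k → mk⇔ (d∣ (toℕ k) ∘ Equivalence.to (rot-toℕ k)) (multiple∈ k)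
    where
    d : ℕ
    d = suc d′

    d∣ : ∀ a → rot [ a ] ∈ H → d ∣ a
    d∣ a a∈ with a % d in a%d≡r
    ... | zero  = m%n≡0⇒n∣m a d a%d≡r
    ... | suc r = ⊥-elim (below r (≤-pred (subst (_< d) a%d≡r (m%n<n a d))) r∈)
      where
      a≡ : a ≡ suc r + (a / d) * d
      a≡ = trans (m≡m%n+[m/n]*n a d) (cong (_+ (a / d) * d) a%d≡r)
      r∈ : rot [ suc r ] ∈ H
      r∈ = rot-∸ (suc r) ((a / d) * d) (rot∈-cong (cong [_] a≡) a∈) (rot-multiple d (a / d) d∈)

    multiple∈ : ∀ k → d ∣ toℕ k → rot k ∈ H
    multiple∈ k (divides q k≡qd) =
      Equivalence.from (rot-toℕ k) (rot∈-cong (cong [_] (sym k≡qd)) (rot-multiple d q d∈))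

  reflection-free⇒⟨a^⟩ : (∀ k → ¬ ref k ∈ H) → ¬ IsTrivial H →
                         ∃[ d ] (d ∣ n × 1 ≤ d × d < n) × ⟨a^ d ⟩ ≡ H
  reflection-free⇒⟨a^⟩ no-ref nontrivial with rotation-part
  ... | d , d∣n , 1≤d , rot∈⇔ = d , (d∣n , 1≤d , d<n) , SubD-ext ⟨a^d⟩⊆H H⊆⟨a^d⟩
    where
    ⟨a^d⟩⊆H : ∀ x → x ∈ ⟨a^ d ⟩ → x ∈ H
    ⟨a^d⟩⊆H (rot k) k∈ = Equivalence.from (rot∈⇔ k) (Equivalence.to (∈⟨a^⟩ d (rot k)) k∈)
    ⟨a^d⟩⊆H (ref k) k∈ = ⊥-elim (Equivalence.to (∈⟨a^⟩ d (ref k)) k∈)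

    H⊆⟨a^d⟩ : ∀ x → x ∈ H → x ∈ ⟨a^ d ⟩
    H⊆⟨a^d⟩ (rot k) k∈ = Equivalence.from (∈⟨a^⟩ d (rot k)) (Equivalence.to (rot∈⇔ k) k∈)
    H⊆⟨a^d⟩ (ref k) k∈ = ⊥-elim (no-ref k k∈)

    -- for d = n the only element of H would be the identity
    d<n : d < n
    d<n with m≤n⇒m<n∨m≡n (∣⇒≤ d∣n)
    ... | inj₁ d<n = d<n
    ... | inj₂ d≡n = ⊥-elim (nontrivial trivial)
      where
      k≡0 : ∀ k → rot k ∈ H → k ≡ 0ₙ
      k≡0 k k∈ = toℕ-injective (begin
        toℕ k      ≡⟨ m<n⇒m%n≡m (toℕ<n k) ⟨
        toℕ k % n  ≡⟨ n∣m⇒m%n≡0 (toℕ k) n n∣k ⟩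
        0          ≡⟨ toℕ-0ₙ ⟨
        toℕ 0ₙ     ∎)
        where
        open ≡-Reasoning
        n∣k : n ∣ toℕ k
        n∣k = subst (_∣ toℕ k) d≡n (Equivalence.to (rot∈⇔ k) k∈)
      trivial : IsTrivial H
      trivial (rot k) = mk⇔ (cong rot ∘ k≡0 k) (λ { refl → one∈ })
      trivial (ref k) = mk⇔ (⊥-elim ∘ no-ref k) (λ ())

  -- Normal subgroups containing a reflection aᵏ⁰b contain every a²ᵗ, namely
  -- (aᵗ · aᵏ⁰b · a⁻ᵗ) · aᵏ⁰b.
  doubles∈ : IsNormal H → ∀ {k₀} → ref k₀ ∈ H → ∀ t → rot [ t + t ] ∈ H
  doubles∈ H◁ {k₀} k₀∈ t = rot∈-cong (trans (conjugate-twice [ t ] k₀) ([]-+ t t))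
    (mul∈ ((rot [ t ] · ref k₀) · inv (rot [ t ])) (ref k₀) (H◁ (rot [ t ]) (ref k₀) k₀∈) k₀∈)

  odd-rotation⇒all : (∀ t → rot [ t + t ] ∈ H) →
                     ∀ o → rot [ o ] ∈ H → parity o ≡ 1ℙ → ∀ k → rot k ∈ H
  odd-rotation⇒all doubles o o∈ o-odd k = Equivalence.from (rot-toℕ k) (rotation∈ (toℕ k))
    where
    rotation∈ : ∀ c → rot [ c ] ∈ H
    rotation∈ c with parity c in c-parity
    ... | 0ℙ = let (t , c≡t+t) = even⇒double c c-parity
               in rot∈-cong (cong [_] (sym c≡t+t)) (doubles t)
    ... | 1ℙ = let c+o-even = trans (+-homo-+ c o) (cong₂ ℙ._+_ c-parity o-odd)
                   (t , c+o≡t+t) = even⇒double (c + o) c+o-even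
               in rot-∸ c o (rot∈-cong (cong [_] (sym c+o≡t+t)) (doubles t)) o∈

  -- for odd n, a normal subgroup containing a reflection is all of Dₙ
  -- (take aᵒ = aⁿ = 1)
  odd-normal-reflection⇒whole : parity n ≡ 1ℙ → IsNormal H → ∀ {k₀} → ref k₀ ∈ H → IsWhole H
  odd-normal-reflection⇒whole n-odd H◁ k₀∈ =
    all-rotations⇒whole k₀∈ (odd-rotation⇒all (doubles∈ H◁ k₀∈) n rot-n n-odd)

  proper-normal-reflection⇒even-rotations :
    IsNormal H → ¬ IsWhole H → ∀ {k₀} → ref k₀ ∈ H →
    ∀ k → rot k ∈ H ⇔ parity (toℕ k) ≡ 0ℙ
  proper-normal-reflection⇒even-rotations H◁ proper k₀∈ k = mk⇔ even even⇒∈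
    where
    even : rot k ∈ H → parity (toℕ k) ≡ 0ℙ
    even k∈ with parity (toℕ k) in k-parity
    ... | 0ℙ = refl
    ... | 1ℙ = ⊥-elim (proper (all-rotations⇒whole k₀∈ (odd-rotation⇒all (doubles∈ H◁ k₀∈)
                 (toℕ k) (Equivalence.to (rot-toℕ k) k∈) k-parity)))
    even⇒∈ : parity (toℕ k) ≡ 0ℙ → rot k ∈ H
    even⇒∈ k-even =
      let (t , k≡t+t) = even⇒double (toℕ k) k-even
      in Equivalence.from (rot-toℕ k) (rot∈-cong (cong [_] (sym k≡t+t)) (doubles∈ H◁ k₀∈ t))

-- Kernels of homomorphisms φ : Dₙ → ℤ/2ℤ

module _ {n : ℕ} .{{_ : NonZero n}}
         (φ : Dih n → Parity) (φ-hom : ∀ x y → φ (x · y) ≡ φ x ℙ.+ φ y) where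

  ker : SubD n
  ker = ⟦ (λ x → φ x ℙₚ.≟ 0ℙ) ⟧

  ∈ker : ∀ x → x ∈ ker ⇔ φ x ≡ 0ℙ
  ∈ker = ∈⟦⟧ (λ x → φ x ℙₚ.≟ 0ℙ)

  φ-e : φ e ≡ 0ℙ
  φ-e = trans (cong φ (sym (·-identityˡ e))) (trans (φ-hom e e) (ℙₚ.p+p≡0ℙ (φ e)))

  φ-inv : ∀ x → φ (inv x) ≡ φ x
  φ-inv x = ℙₚ.+-cancelˡ-≡ (φ x) (φ (inv x)) (φ x) (begin
    φ x ℙ.+ φ (inv x)   ≡⟨ φ-hom x (inv x) ⟨
    φ (x · inv x)       ≡⟨ cong φ (·-inverseʳ x) ⟩
    φ e                 ≡⟨ φ-e ⟩
    0ℙ                  ≡⟨ ℙₚ.p+p≡0ℙ (φ x) ⟨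
    φ x ℙ.+ φ x         ∎)
    where open ≡-Reasoning

  private
    into : ∀ {x} → φ x ≡ 0ℙ → x ∈ ker
    into = Equivalence.from (∈ker _)
    out : ∀ {x} → x ∈ ker → φ x ≡ 0ℙ
    out = Equivalence.to (∈ker _)

  ker-subgroup : IsSubgroup ker
  ker-subgroup = record
    { one∈ = into φ-e
    ; mul∈ = λ x y x∈ y∈ → into (trans (φ-hom x y) (cong₂ ℙ._+_ (out x∈) (out y∈)))
    ; inv∈ = λ x x∈ → into (trans (φ-inv x) (out x∈)) }

  ker-normal : IsNormal ker
  ker-normal g h h∈ = into (begin
    φ ((g · h) · inv g)          ≡⟨ φ-hom (g · h) (inv g) ⟩
    φ (g · h) ℙ.+ φ (inv g)      ≡⟨ cong₂ ℙ._+_ (φ-hom g h) (φ-inv g) ⟩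
    (φ g ℙ.+ φ h) ℙ.+ φ g        ≡⟨ cong (λ p → (φ g ℙ.+ p) ℙ.+ φ g) (out h∈) ⟩
    (φ g ℙ.+ 0ℙ) ℙ.+ φ g         ≡⟨ cong (ℙ._+ φ g) (ℙₚ.+-identityʳ (φ g)) ⟩
    φ g ℙ.+ φ g                  ≡⟨ ℙₚ.p+p≡0ℙ (φ g) ⟩
    0ℙ                           ∎)
    where open ≡-Reasoning

  -- a subgroup having the rotations of ker φ and one reflection of ker φ is
  -- ker φ, because its reflections form a single coset of its rotations
  ker-classification : ∀ {H} → IsSubgroup H → (∀ k → rot k ∈ H ⇔ φ (rot k) ≡ 0ℙ) →
                       ∀ {k₀} → ref k₀ ∈ H → φ (ref k₀) ≡ 0ℙ → ker ≡ H
  ker-classification {H} H≤ rot∈⇔ {k₀} k₀∈ φk₀≡0 =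
    SubD-ext (λ x → Equivalence.from (same x) ∘ out) (λ x → into ∘ Equivalence.to (same x))
    where
    φ-coset : ∀ k → φ (rot (k +ₙ -ₙ k₀)) ≡ φ (ref k)
    φ-coset k = begin
      φ (ref k · ref k₀)         ≡⟨ φ-hom (ref k) (ref k₀) ⟩
      φ (ref k) ℙ.+ φ (ref k₀)   ≡⟨ cong (φ (ref k) ℙ.+_) φk₀≡0 ⟩
      φ (ref k) ℙ.+ 0ℙ           ≡⟨ ℙₚ.+-identityʳ (φ (ref k)) ⟩
      φ (ref k)                  ∎
      where open ≡-Reasoning
    same : ∀ x → x ∈ H ⇔ φ x ≡ 0ℙ
    same (rot k) = rot∈⇔ k
    same (ref k) = ⇔-trans (reflection-coset H≤ k₀∈ k)
                           (⇔-trans (rot∈⇔ (k +ₙ -ₙ k₀))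
                                    (mk⇔ (trans (sym (φ-coset k))) (trans (φ-coset k))))

-- For even n, the exponent parity gives homomorphisms χ_b : Dₙ → ℤ/2ℤ
-- (b ∈ ℤ/2ℤ) with χ_b(aᵏ) = k and χ_b(aᵏb) = k + b; their kernels are the
-- two normal subgroups ⟨a², b⟩ and ⟨a², ab⟩ of index 2.

ℙ-swap : ∀ p q r → (p ℙ.+ q) ℙ.+ r ≡ (p ℙ.+ r) ℙ.+ q
ℙ-swap p q r =
  trans (ℙₚ.+-assoc p q r) (trans (cong (p ℙ.+_) (ℙₚ.+-comm q r)) (sym (ℙₚ.+-assoc p r q)))

ℙ-shift : ∀ p q r → p ℙ.+ q ≡ (p ℙ.+ r) ℙ.+ (q ℙ.+ r)
ℙ-shift 0ℙ 0ℙ 0ℙ = refl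
ℙ-shift 0ℙ 0ℙ 1ℙ = refl
ℙ-shift 0ℙ 1ℙ 0ℙ = refl
ℙ-shift 0ℙ 1ℙ 1ℙ = refl
ℙ-shift 1ℙ 0ℙ 0ℙ = refl
ℙ-shift 1ℙ 0ℙ 1ℙ = refl
ℙ-shift 1ℙ 1ℙ 0ℙ = refl
ℙ-shift 1ℙ 1ℙ 1ℙ = refl

module _ {n : ℕ} .{{_ : NonZero n}} (n-even : parity n ≡ 0ℙ) where

  parity-% : ∀ a → parity (a % n) ≡ parity a
  parity-% a = sym (begin
    parity a                                   ≡⟨ cong parity (m≡m%n+[m/n]*n a n) ⟩
    parity (a % n + (a / n) * n)               ≡⟨ +-homo-+ (a % n) ((a / n) * n) ⟩
    parity (a % n) ℙ.+ parity ((a / n) * n)    ≡⟨ cong (parity (a % n) ℙ.+_) multiple-even ⟩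
    parity (a % n) ℙ.+ 0ℙ                      ≡⟨ ℙₚ.+-identityʳ (parity (a % n)) ⟩
    parity (a % n)                             ∎)
    where
    open ≡-Reasoning
    multiple-even : parity ((a / n) * n) ≡ 0ℙ
    multiple-even = trans (*-homo-* (a / n) n)
                          (trans (cong (parity (a / n) ℙ.*_) n-even) (ℙₚ.*-zeroʳ (parity (a / n))))

  parity-+ₙ : ∀ i j → parity (toℕ (i +ₙ j)) ≡ parity (toℕ i) ℙ.+ parity (toℕ j)
  parity-+ₙ i j = trans (cong parity (toℕ-[] _)) (trans (parity-% _) (+-homo-+ (toℕ i) (toℕ j)))

  parity--ₙ : ∀ i → parity (toℕ (-ₙ i)) ≡ parity (toℕ i)
  parity--ₙ i = ℙₚ.+-cancelʳ-≡ (parity (toℕ i)) _ _ (begin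
    parity (toℕ (-ₙ i)) ℙ.+ parity (toℕ i)   ≡⟨ parity-+ₙ (-ₙ i) i ⟨
    parity (toℕ (-ₙ i +ₙ i))                 ≡⟨ cong (parity ∘ toℕ) (+ₙ-inverseˡ i) ⟩
    parity (toℕ 0ₙ)                          ≡⟨ cong parity toℕ-0ₙ ⟩
    0ℙ                                       ≡⟨ ℙₚ.p+p≡0ℙ (parity (toℕ i)) ⟨
    parity (toℕ i) ℙ.+ parity (toℕ i)        ∎)
    where open ≡-Reasoning

  parity-sub : ∀ i j → parity (toℕ (i +ₙ -ₙ j)) ≡ parity (toℕ i) ℙ.+ parity (toℕ j)
  parity-sub i j = trans (parity-+ₙ i (-ₙ j)) (cong (parity (toℕ i) ℙ.+_) (parity--ₙ j))

  private
    pᵢ : Fin n → Parity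
    pᵢ = parity ∘ toℕ

  χ : Parity → Dih n → Parity
  χ b (rot k) = parity (toℕ k)
  χ b (ref k) = parity (toℕ k) ℙ.+ b

  χ-hom : ∀ b x y → χ b (x · y) ≡ χ b x ℙ.+ χ b y
  χ-hom b (rot i) (rot j) = parity-+ₙ i j
  χ-hom b (rot i) (ref j) = trans (cong (ℙ._+ b) (parity-+ₙ i j)) (ℙₚ.+-assoc (pᵢ i) (pᵢ j) b)
  χ-hom b (ref i) (rot j) = trans (cong (ℙ._+ b) (parity-sub i j)) (ℙ-swap (pᵢ i) (pᵢ j) b)
  χ-hom b (ref i) (ref j) = trans (parity-sub i j) (ℙ-shift (pᵢ i) (pᵢ j) b)

  Kχ : Parity → SubD n
  Kχ b = ker (χ b) (χ-hom b)

  private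
    into : ∀ b x → χ b x ≡ 0ℙ → x ∈ Kχ b
    into b x = Equivalence.from (∈ker (χ b) (χ-hom b) x)
    out : ∀ b x → x ∈ Kχ b → χ b x ≡ 0ℙ
    out b x = Equivalence.to (∈ker (χ b) (χ-hom b) x)

  χ-ref0 : ∀ b → χ b (ref 0ₙ) ≡ b
  χ-ref0 b = cong (λ k → parity k ℙ.+ b) toℕ-0ₙ

  -- the reflection a⁰b lies in Kχ b exactly when b = 0, so Kχ b determines b
  b≡0⇒b′≡0 : ∀ {b b′} → Kχ b ≡ Kχ b′ → b ≡ 0ℙ → b′ ≡ 0ℙ
  b≡0⇒b′≡0 {b} {b′} eq b≡0 =
    trans (sym (χ-ref0 b′)) (out b′ (ref 0ₙ) (subst (ref 0ₙ ∈_) eq b∈Kχb))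
    where
    b∈Kχb : ref 0ₙ ∈ Kχ b
    b∈Kχb = into b (ref 0ₙ) (trans (χ-ref0 b) b≡0)

  Kχ-injective : ∀ b b′ → Kχ b ≡ Kχ b′ → b ≡ b′
  Kχ-injective 0ℙ 0ℙ _ = refl
  Kχ-injective 1ℙ 1ℙ _ = refl
  Kχ-injective 0ℙ 1ℙ eq with b≡0⇒b′≡0 eq refl
  ... | ()
  Kχ-injective 1ℙ 0ℙ eq with b≡0⇒b′≡0 (sym eq) refl
  ... | ()

  Kχ-reflection : 1 < n → ∀ b → ∃[ k ] ref k ∈ Kχ b
  Kχ-reflection 1<n 0ℙ = 0ₙ , into 0ℙ (ref 0ₙ) (χ-ref0 0ℙ)
  Kχ-reflection 1<n 1ℙ =
    [ 1 ] , into 1ℙ (ref [ 1 ]) (cong (λ k → parity k ℙ.+ 1ℙ) (toℕ-[]< 1<n))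

  -- a is not in Kχ b
  Kχ-proper : 1 < n → ∀ b → ¬ IsWhole (Kχ b)
  Kχ-proper 1<n b whole with
    trans (sym (cong parity (toℕ-[]< 1<n))) (out b (rot [ 1 ]) (whole (rot [ 1 ])))
  ... | ()

  -- a² is a nonidentity element of Kχ b
  Kχ-nontrivial : 2 < n → ∀ b → ¬ IsTrivial (Kχ b)
  Kχ-nontrivial 2<n b trivial = 0≢1+n (sym 2≡0)
    where
    a²≡e : rot [ 2 ] ≡ e
    a²≡e = Equivalence.to (trivial (rot [ 2 ])) (into b (rot [ 2 ]) (cong parity (toℕ-[]< 2<n)))
    2≡0 : 2 ≡ 0
    2≡0 = trans (sym (toℕ-[]< 2<n)) (trans (cong toℕ (rot-injective a²≡e)) toℕ-0ₙ)

  proper-normal-reflection⇒Kχ : ∀ {H} → IsSubgroup H → IsNormal H → ¬ IsWhole H →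
                                ∀ {k₀} → ref k₀ ∈ H → Kχ (parity (toℕ k₀)) ≡ H
  proper-normal-reflection⇒Kχ H≤ H◁ proper {k₀} k₀∈ =
    ker-classification (χ b) (χ-hom b) H≤
      (proper-normal-reflection⇒even-rotations H≤ H◁ proper k₀∈) k₀∈ (ℙₚ.p+p≡0ℙ b)
    where
    b : Parity
    b = parity (toℕ k₀)

-- The enumerations: the rotation subgroups ⟨aᵈ⟩ for the proper divisors d
-- of n, and for even n additionally the two kernels Kχ b.

module _ {n : ℕ} .{{_ : NonZero n}} where

  private
    D : Set
    D = Fin (length (properDivisors n))

    divisorAt : D → ℕ
    divisorAt = lookup (properDivisors n)

    divisorAt-proper : ∀ i → divisorAt i ∣ n × 1 ≤ divisorAt i × divisorAt i < n
    divisorAt-proper i = Equivalence.to ∈-properDivisors (∈-lookup i)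

    position : ∀ {d} → d ∣ n × 1 ≤ d × d < n → ∃[ i ] divisorAt i ≡ d
    position d-proper = let p = Equivalence.from ∈-properDivisors d-proper
                        in Any.index p , sym (lookup-index p)

    ⟨a^divisor⟩ : D → SubD n
    ⟨a^divisor⟩ i = ⟨a^ divisorAt i ⟩

    ⟨a^divisor⟩-injective : ∀ i j → ⟨a^divisor⟩ i ≡ ⟨a^divisor⟩ j → i ≡ j
    ⟨a^divisor⟩-injective i j eq = lookup-injective (properDivisors-unique n) i j
      (⟨a^⟩-injective (below-n i) (below-n j) eq)
      where
      below-n : ∀ i → divisorAt i < n
      below-n = proj₂ ∘ proj₂ ∘ divisorAt-proper

    ⟨a^divisor⟩-subgroup : ∀ i → IsSubgroup (⟨a^divisor⟩ i)
    ⟨a^divisor⟩-subgroup i = ⟨a^⟩-subgroup (proj₁ (divisorAt-proper i))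

    ⟨a^divisor⟩-normal : ∀ i → IsNormal (⟨a^divisor⟩ i)
    ⟨a^divisor⟩-normal i = ⟨a^⟩-normal (proj₁ (divisorAt-proper i))

    ⟨a^divisor⟩-nontrivial : ∀ i → ¬ IsTrivial (⟨a^divisor⟩ i)
    ⟨a^divisor⟩-nontrivial i = let (d∣n , 1≤d , d<n) = divisorAt-proper i
                               in ⟨a^⟩-nontrivial d∣n 1≤d d<n

    ⟨a^divisor⟩-proper : ∀ i → ¬ IsWhole (⟨a^divisor⟩ i)
    ⟨a^divisor⟩-proper i = ⟨a^⟩-proper (proj₁ (divisorAt-proper i))

    ⟨a^divisor⟩-complete : ∀ H → IsSubgroup H → ¬ IsTrivial H → (∀ k → ¬ ref k ∈ H) →
                           ∃[ i ] ⟨a^divisor⟩ i ≡ H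
    ⟨a^divisor⟩-complete H H≤ nontrivial no-ref =
      let (d , d-proper , ⟨a^d⟩≡H) = reflection-free⇒⟨a^⟩ H≤ no-ref nontrivial
          (i , divisorAt-i≡d)      = position d-proper
      in i , trans (cong ⟨a^_⟩ divisorAt-i≡d) ⟨a^d⟩≡H

  oddEnumeration : parity n ≡ 1ℙ → NormalEnumeration n D
  oddEnumeration n-odd = record
    { subgroupAt = ⟨a^divisor⟩
    ; injective  = ⟨a^divisor⟩-injective
    ; subgroup   = ⟨a^divisor⟩-subgroup
    ; normal     = ⟨a^divisor⟩-normal
    ; nontrivial = ⟨a^divisor⟩-nontrivial
    ; proper     = ⟨a^divisor⟩-proper
    ; complete   = λ H H≤ H◁ nontrivial proper → ⟨a^divisor⟩-complete H H≤ nontrivial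
                     (λ k k∈ → proper (odd-normal-reflection⇒whole H≤ n-odd H◁ k∈)) }

  evenEnumeration : (n-even : parity n ≡ 0ℙ) → 2 < n → NormalEnumeration n (D ⊎ Parity)
  evenEnumeration n-even 2<n = record
    { subgroupAt = subgroupAt
    ; injective  = injective
    ; subgroup   = λ { (inj₁ i) → ⟨a^divisor⟩-subgroup i
                     ; (inj₂ b) → ker-subgroup (χ n-even b) (χ-hom n-even b) }
    ; normal     = λ { (inj₁ i) → ⟨a^divisor⟩-normal i
                     ; (inj₂ b) → ker-normal (χ n-even b) (χ-hom n-even b) }
    ; nontrivial = λ { (inj₁ i) → ⟨a^divisor⟩-nontrivial i
                     ; (inj₂ b) → Kχ-nontrivial n-even 2<n b }
    ; proper     = λ { (inj₁ i) → ⟨a^divisor⟩-proper i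
                     ; (inj₂ b) → Kχ-proper n-even 1<n b }
    ; complete   = complete }
    where
    1<n : 1 < n
    1<n = <⇒≤ 2<n

    subgroupAt : D ⊎ Parity → SubD n
    subgroupAt (inj₁ i) = ⟨a^divisor⟩ i
    subgroupAt (inj₂ b) = Kχ n-even b

    -- Kχ b contains a reflection, ⟨aᵈ⟩ does not
    ⟨a^⟩≢Kχ : ∀ i b → ⟨a^divisor⟩ i ≢ Kχ n-even b
    ⟨a^⟩≢Kχ i b eq = let (k , k∈) = Kχ-reflection n-even 1<n b
                      in Equivalence.to (∈⟨a^⟩ (divisorAt i) (ref k)) (subst (ref k ∈_) (sym eq) k∈)

    injective : ∀ x y → subgroupAt x ≡ subgroupAt y → x ≡ y
    injective (inj₁ i) (inj₁ j) eq = cong inj₁ (⟨a^divisor⟩-injective i j eq)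
    injective (inj₁ i) (inj₂ b) eq = ⊥-elim (⟨a^⟩≢Kχ i b eq)
    injective (inj₂ b) (inj₁ i) eq = ⊥-elim (⟨a^⟩≢Kχ i b (sym eq))
    injective (inj₂ b) (inj₂ c) eq = cong inj₂ (Kχ-injective n-even b c eq)

    complete : ∀ H → IsSubgroup H → IsNormal H → ¬ IsTrivial H → ¬ IsWhole H →
               ∃[ x ] subgroupAt x ≡ H
    complete H H≤ H◁ nontrivial proper with any? (λ k → ref k ∈? H)
    ... | yes (k₀ , k₀∈) =
      inj₂ (parity (toℕ k₀)) , proper-normal-reflection⇒Kχ n-even H≤ H◁ proper k₀∈
    ... | no no-ref =
      let (i , eq) = ⟨a^divisor⟩-complete H H≤ nontrivial (λ k k∈ → no-ref (k , k∈))
      in inj₁ i , eq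

2↔Parity : Fin 2 ↔ Parity
2↔Parity = mk↔ₛ′ (λ { Fin.zero → 0ℙ ; (Fin.suc Fin.zero) → 1ℙ })
                 (λ { 0ℙ → Fin.zero ; 1ℙ → Fin.suc Fin.zero })
                 (λ { 0ℙ → refl ; 1ℙ → refl })
                 (λ { Fin.zero → refl ; (Fin.suc Fin.zero) → refl })

theorem4p8 : (n : ℕ) .{{_ : NonZero n}} → 3 ≤ n →
    ((2 ∣ n) → Γ n ≅ (K (τ n + 1) ⊞ ΓN n))
    × (¬ (2 ∣ n) → Γ n ≅ (K (τ n ∸ 1) ⊞ ΓN n))
theorem4p8 n 2<n = even , odd
  where
  ℓ : ℕ
  ℓ = length (properDivisors n)

  Γ≅K_⊞ΓN : ℕ → Set
  Γ≅K_⊞ΓN r = Γ n ≅ (K r ⊞ ΓN n)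

  even : 2 ∣ n → Γ≅K (τ n + 1) ⊞ΓN
  even 2∣n = subst Γ≅K_⊞ΓN (sym τ+1≡ℓ+2)
    (Γ≅K⊞ΓN (reindex index↔ (evenEnumeration (2∣⇒even 2∣n) 2<n)))
    where
    index↔ : Fin (ℓ + 2) ↔ (Fin ℓ ⊎ Parity)
    index↔ = ↔-trans +↔⊎ (↔-refl ⊎-↔ 2↔Parity)
    τ+1≡ℓ+2 : τ n + 1 ≡ ℓ + 2
    τ+1≡ℓ+2 = trans (cong (_+ 1) (τ≡properDivisors+1 n)) (+-assoc ℓ 1 1)

  odd : ¬ 2 ∣ n → Γ≅K (τ n ∸ 1) ⊞ΓN
  odd ¬2∣n = subst Γ≅K_⊞ΓN (sym τ∸1≡ℓ) (Γ≅K⊞ΓN (oddEnumeration (¬2∣⇒odd ¬2∣n)))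
    where
    τ∸1≡ℓ : τ n ∸ 1 ≡ ℓ
    τ∸1≡ℓ = trans (cong (_∸ 1) (τ≡properDivisors+1 n)) (m+n∸n≡m ℓ 1)
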